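{- Let $A \subseteq [2n]$ be nonempty. For an ID tree $T$ on node set $A$, order the children of each even node in increasing order and the children of each odd node in decreasing order, making $T$ a rooted planar tree, and let $\alpha_1,\dots,\alpha_{|A|}$ be the nodes of $T$ listed in postorder (children subtrees traversed in the given order, each node listed after all nodes of its subtrees). Define $\psi_A(T)$ to be the permutation of $A$ whose cycle form is $(\alpha_1,\alpha_2,\dots,\alpha_{|A|})$. Then $\psi_A$ is a well-defined bijection from the set $\mathcal T_A$ of ID trees on $A$ to the set $\mathcal{DC}_A$ of D-cycles on $A$. Consequently $|\mathcal T_A|=|\mathcal{DC}_A|$.
   Context: A rooted forest on a finite node set $A\subset\mathbb Z^+$ is increasing-decreasing (ID) if each tree is rooted at its largest node and for each internal node $a$: if $a$ is odd then $a$ is less than all its descendants and all its children are even; if $a$ is even then $a$ is greater than all its descendants and all its children are odd. An ID tree is an ID forest consisting of a single tree. A permutation $\sigma$ of $A$ is a D-permutation if $i\le\sigma(i)$ for odd $i$ and $i\ge\sigma(i)$ for even $i$; a D-cycle on $A$ is a D-permutation of $A$ consisting of a single cycle. -}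

module Defs where

open import Data.Nat using (ℕ; zero; suc; _+_; _*_; _≤_; _<_; _>_; _≟_)
open import Data.Nat.Divisibility using (_∣_)
open import Data.Bool using (if_then_else_)
open import Data.List using (List; []; _∷_; _++_; [_]; map)
open import Data.List.Membership.Propositional using (_∈_)
open import Data.List.Relation.Unary.All using (All)
open import Data.List.Relation.Unary.Linked using (Linked)
open import Data.List.Relation.Unary.Unique.Propositional using (Unique)
open import Data.List.Relation.Binary.Permutation.Propositional using (_↭_)
open import Data.Product using (Σ; ∃; _×_)
open import Relation.Nullary using (¬_)
open import Relation.Nullary.Decidable using (⌊_⌋)
open import Relation.Binary.PropositionalEquality using (_≡_; _≢_)
open import Function using (_∘_)

Even : ℕ → Set
Even n = 2 ∣ n

Odd : ℕ → Set
Odd n = ¬ (2 ∣ n)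

IsNodeSet : ℕ → List ℕ → Set
IsNodeSet n A = Unique A × All (λ a → 1 ≤ a × a ≤ 2 * n) A × A ≢ []

data Tree : Set where
  node : ℕ → List Tree → Tree

root : Tree → ℕ
root (node a _) = a

children : Tree → List Tree
children (node _ ts) = ts

-- node labels (preorder; used only as the node multiset)
nodes  : Tree → List ℕ
nodesF : List Tree → List ℕ
nodes (node a ts) = a ∷ nodesF ts
nodesF [] = []
nodesF (t ∷ ts) = nodes t ++ nodesF ts

subtrees  : Tree → List Tree
subtreesF : List Tree → List Tree
subtrees (node a ts) = node a ts ∷ subtreesF ts
subtreesF [] = []
subtreesF (t ∷ ts) = subtrees t ++ subtreesF ts

descendants : Tree → List ℕ
descendants t = nodesF (children t)

postorder  : Tree → List ℕ
postorderF : List Tree → List ℕ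
postorder (node a ts) = postorderF ts ++ [ a ]
postorderF [] = []
postorderF (t ∷ ts) = postorder t ++ postorderF ts

IDLocal : Tree → Set
IDLocal t =
  children t ≢ [] →
    (Odd (root t) → All (root t <_) (descendants t) × All (Even ∘ root) (children t))
  × (Even (root t) → All (_< root t) (descendants t) × All (Odd ∘ root) (children t))

CanonicalOrder : Tree → Set
CanonicalOrder t =
    (Even (root t) → Linked _<_ (map root (children t)))
  × (Odd (root t) → Linked _>_ (map root (children t)))

-- An (unordered) ID tree on node set A, represented by its unique planar
-- representative whose children are ordered as in the paper.
IsIDTree : List ℕ → Tree → Set
IsIDTree A t =
    nodes t ↭ A
  × All (_≤ root t) (nodes t)
  × All IDLocal (subtrees t)
  × All CanonicalOrder (subtrees t)

-- Permutations of A, D-permutations, D-cycles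
-- (a permutation of A is a map ℕ → ℕ restricting to a bijection of A;
--  values outside A are irrelevant, permutations are compared pointwise on A)

iter : (ℕ → ℕ) → ℕ → ℕ → ℕ
iter σ zero x = x
iter σ (suc k) x = σ (iter σ k x)

IsPermutationOf : List ℕ → (ℕ → ℕ) → Set
IsPermutationOf A σ =
    (∀ {x} → x ∈ A → σ x ∈ A)
  × (∀ {x y} → x ∈ A → y ∈ A → σ x ≡ σ y → x ≡ y)
  × (∀ {y} → y ∈ A → ∃ λ x → x ∈ A × σ x ≡ y)

IsDPermutation : List ℕ → (ℕ → ℕ) → Set
IsDPermutation A σ =
    IsPermutationOf A σ
  × (∀ {i} → i ∈ A → Odd i → i ≤ σ i)
  × (∀ {i} → i ∈ A → Even i → σ i ≤ i)

IsDCycle : List ℕ → (ℕ → ℕ) → Set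
IsDCycle A σ =
    IsDPermutation A σ
  × (∀ {x y} → x ∈ A → y ∈ A → ∃ λ k → iter σ k x ≡ y)

-- The permutation with cycle form (α₁, α₂, …, α_k)

nextIn : ℕ → List ℕ → ℕ → ℕ
nextIn f [] y = y
nextIn f (a ∷ []) y = if ⌊ y ≟ a ⌋ then f else y
nextIn f (a ∷ b ∷ rest) y = if ⌊ y ≟ a ⌋ then b else nextIn f (b ∷ rest) y

cycleOf : List ℕ → ℕ → ℕ
cycleOf [] y = y
cycleOf (a ∷ as) y = nextIn a (a ∷ as) y

ψ : Tree → ℕ → ℕ
ψ t = cycleOf (postorder t)

_≈[_]_ : (ℕ → ℕ) → List ℕ → (ℕ → ℕ) → Set
σ ≈[ A ] τ = ∀ {x} → x ∈ A → σ x ≡ τ x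

module Submission where

-- Let M be the largest element of A; it is the root of every ID tree on A,
-- whose postorder therefore has the form p ++ [ M ].  A map σ is the cycle
-- (M, p…) exactly when it satisfies the path equation
--   map σ (M ∷ p) ≡ p ++ [ M ]          (Path σ M p M),
-- and ψ(T) satisfies it (cycleOf-path).

open import Defs
open import Data.Nat using (ℕ; zero; suc; _+_; _*_; _≤_; _<_; _≟_; z≤n; s≤s; s≤s⁻¹; _<?_)
open import Data.Nat.Properties
open import Data.Nat.DivMod using (_%_; _/_; m≡m%n+[m/n]*n; m%n<n)
open import Data.Nat.Divisibility using (_∣?_)
open import Data.Maybe using (just)
open import Data.Maybe.Relation.Binary.Connected using (Connected; just; just-nothing)
open import Data.List using (List; []; _∷_; _++_; [_]; map; length; head; initLast; _∷ʳ′_)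
open import Data.List.Properties
  using (++-assoc; ++-identityʳ; ∷-injective; ∷-injectiveʳ; ∷ʳ-injective; ∷ʳ-injectiveʳ; map-++;
         map-cong-local; length-++-≤ˡ; length-++-≤ʳ; ++-conicalˡ; ++-conicalʳ)
open import Data.List.Membership.Propositional using (_∈_; _∉_)
open import Data.List.Membership.Propositional.Properties using (∈-∃++; ∈-++⁺ˡ; ∈-++⁺ʳ; ∈-map⁺; ∈-map⁻)
open import Data.List.Relation.Unary.Any using (here; there)
open import Data.List.Relation.Unary.All using (All; []; _∷_)
import Data.List.Relation.Unary.All as All
import Data.List.Relation.Unary.All.Properties as All
open import Data.List.Relation.Unary.AllPairs using ([]; _∷_)
import Data.List.Relation.Unary.AllPairs as AllPairs
open import Data.List.Relation.Unary.Linked using (Linked; []; [-]; _∷_; _∷′_)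
import Data.List.Relation.Unary.Linked as Linked
open import Data.List.Relation.Unary.Linked.Properties using (Linked⇒AllPairs)
open import Data.List.Relation.Unary.Unique.Propositional using (Unique)
open import Data.List.Relation.Binary.Permutation.Propositional using (_↭_; prep; ↭-sym; ↭-trans; ↭-refl; ↭⇒↭ₛ)
open import Data.List.Relation.Binary.Permutation.Propositional.Properties
  using (∷↭∷ʳ; All-resp-↭; ∈-resp-↭; ↭-length; shift)
import Data.List.Relation.Binary.Permutation.Propositional.Properties as Perm
open import Data.Product using (Σ; ∃; ∃₂; _×_; _,_; proj₁; proj₂)
open import Data.Sum using (_⊎_; inj₁; inj₂)
open import Data.Empty using (⊥-elim)
open import Relation.Nullary using (¬_; yes; no; Dec)
open import Relation.Binary.PropositionalEquality
  using (_≡_; _≢_; refl; sym; trans; cong; cong₂; subst; module ≡-Reasoning)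
import Relation.Binary.PropositionalEquality as ≡
import Data.List.Relation.Binary.Permutation.Setoid.Properties as PermSetoid
open import Function using (_∘_)

-- Directions.  In an ID tree an odd node lies below all its descendants
-- ("up") and an even node above them ("down").

data Dir : Set where
  up down : Dir

opposite : Dir → Dir
opposite up = down
opposite down = up

HasDir : Dir → ℕ → Set
HasDir up c = Odd c
HasDir down c = Even c

_≺⟨_⟩_ : ℕ → Dir → ℕ → Set
x ≺⟨ up ⟩ y = x < y
x ≺⟨ down ⟩ y = y < x

_≼⟨_⟩_ : ℕ → Dir → ℕ → Set
x ≼⟨ up ⟩ y = x ≤ y
x ≼⟨ down ⟩ y = y ≤ x

-- D-steps: a D-permutation moves odd letters up and even letters down
DStep : ℕ → ℕ → Set
DStep x y = (Odd x → x < y) × (Even x → y < x)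

WeakDStep : ℕ → ℕ → Set
WeakDStep x y = (Odd x → x ≤ y) × (Even x → y ≤ x)

parity : ∀ n → Even n ⊎ Odd n
parity n with 2 ∣? n
... | yes e = inj₁ e
... | no o = inj₂ o

dirOf : ∀ n → Σ Dir λ d → HasDir d n
dirOf n with parity n
... | inj₁ e = down , e
... | inj₂ o = up , o

≺⇒≼ : ∀ {d x y} → x ≺⟨ d ⟩ y → x ≼⟨ d ⟩ y
≺⇒≼ {up} = <⇒≤
≺⇒≼ {down} = <⇒≤

≼-refl : ∀ {d x} → x ≼⟨ d ⟩ x
≼-refl {up} = ≤-refl
≼-refl {down} = ≤-refl

≼-trans : ∀ {d x y z} → x ≼⟨ d ⟩ y → y ≼⟨ d ⟩ z → x ≼⟨ d ⟩ z
≼-trans {up} p q = ≤-trans p q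
≼-trans {down} p q = ≤-trans q p

≼-antisym : ∀ {d x y} → x ≼⟨ d ⟩ y → y ≼⟨ d ⟩ x → x ≡ y
≼-antisym {up} p q = ≤-antisym p q
≼-antisym {down} p q = ≤-antisym q p

≺-≼-trans : ∀ {d x y z} → x ≺⟨ d ⟩ y → y ≼⟨ d ⟩ z → x ≺⟨ d ⟩ z
≺-≼-trans {up} p q = <-≤-trans p q
≺-≼-trans {down} p q = ≤-<-trans q p

≺-trans : ∀ {d x y z} → x ≺⟨ d ⟩ y → y ≺⟨ d ⟩ z → x ≺⟨ d ⟩ z
≺-trans p q = ≺-≼-trans p (≺⇒≼ q)

≺-irrefl : ∀ {d x} → ¬ (x ≺⟨ d ⟩ x)
≺-irrefl {up} = <-irrefl refl
≺-irrefl {down} = <-irrefl refl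

≺-opposite : ∀ {d x y} → x ≺⟨ d ⟩ y → y ≺⟨ opposite d ⟩ x
≺-opposite {up} p = p
≺-opposite {down} p = p

≺-connex : ∀ {d x y} → ¬ (x ≺⟨ d ⟩ y) → y ≼⟨ d ⟩ x
≺-connex {up} = ≮⇒≥
≺-connex {down} = ≮⇒≥

≼∧≢⇒≺ : ∀ {d x y} → x ≼⟨ d ⟩ y → x ≢ y → x ≺⟨ d ⟩ y
≼∧≢⇒≺ {up} le ne = ≤∧≢⇒< le ne
≼∧≢⇒≺ {down} le ne = ≤∧≢⇒< le (ne ∘ sym)

_≺?⟨_⟩_ : ∀ x d y → Dec (x ≺⟨ d ⟩ y)
x ≺?⟨ up ⟩ y = x <? y
x ≺?⟨ down ⟩ y = y <? x

directed⇒DStep : ∀ {d x y} → HasDir d x → x ≺⟨ d ⟩ y → DStep x y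
directed⇒DStep {up} o lt = (λ _ → lt) , (λ e → ⊥-elim (o e))
directed⇒DStep {down} e lt = (λ o → ⊥-elim (o e)) , (λ _ → lt)

DStep-dir : ∀ {d x y} → DStep x y → x ≼⟨ d ⟩ y → HasDir d x
DStep-dir {up} {x} (_ , goesDown) le with parity x
... | inj₁ e = ⊥-elim (<⇒≱ (goesDown e) le)
... | inj₂ o = o
DStep-dir {down} {x} (goesUp , _) le with parity x
... | inj₁ e = e
... | inj₂ o = ⊥-elim (<⇒≱ (goesUp o) le)

DStep⇒WeakDStep : ∀ {x y} → DStep x y → WeakDStep x y
DStep⇒WeakDStep (f , g) = <⇒≤ ∘ f , <⇒≤ ∘ g

WeakDStep⇒DStep : ∀ {x y} → WeakDStep x y → x ≢ y → DStep x y
WeakDStep⇒DStep (f , g) ne = (λ o → ≤∧≢⇒< (f o) ne) , (λ e → ≤∧≢⇒< (g e) (ne ∘ sym))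

linked-weak⇒strict : ∀ {xs} → Linked WeakDStep xs → Unique xs → Linked DStep xs
linked-weak⇒strict [] _ = []
linked-weak⇒strict [-] _ = [-]
linked-weak⇒strict (step ∷ l) ((x≢y ∷ _) ∷ uq) = WeakDStep⇒DStep step x≢y ∷ linked-weak⇒strict l uq

module _ {X : Set} where

  LastP : (X → Set) → List X → Set
  LastP P w = ∀ u c → w ≡ u ++ [ c ] → P c

  lastP-[] : ∀ {P} → LastP P []
  lastP-[] [] c ()
  lastP-[] (_ ∷ _) c ()

  lastP-[_] : ∀ {P x} → P x → LastP P [ x ]
  lastP-[ px ] [] c refl = px
  lastP-[ px ] (_ ∷ []) c ()
  lastP-[ px ] (_ ∷ _ ∷ _) c ()

  lastP-∷ : ∀ {P x y ys} → LastP P (y ∷ ys) → LastP P (x ∷ y ∷ ys)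
  lastP-∷ last [] c ()
  lastP-∷ last (_ ∷ u) c eq = last u c (∷-injectiveʳ eq)

  splitSuffix : ∀ {P : X → Set} → (∀ x → Dec (P x)) → ∀ u →
    ∃₂ λ u₁ v → u ≡ u₁ ++ v × All P v × LastP (¬_ ∘ P) u₁
  splitSuffix P? [] = [] , [] , refl , [] , lastP-[]
  splitSuffix P? (x ∷ u) with splitSuffix P? u
  ... | y ∷ u₁ , v , refl , allv , last = x ∷ y ∷ u₁ , v , refl , allv , lastP-∷ last
  ... | [] , v , refl , allv , _ with P? x
  ...   | yes px = [] , x ∷ v , refl , px ∷ allv , lastP-[]
  ...   | no ¬px = [ x ] , v , refl , allv , lastP-[ ¬px ]

  unique-resp-↭ : ∀ {xs ys : List X} → xs ↭ ys → Unique xs → Unique ys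
  unique-resp-↭ p = PermSetoid.Unique-resp-↭ (≡.setoid X) (↭⇒↭ₛ p)

  unique-++ˡ : ∀ xs {ys : List X} → Unique (xs ++ ys) → Unique xs
  unique-++ˡ [] _ = []
  unique-++ˡ (x ∷ xs) (x∉ ∷ uq) = All.++⁻ˡ xs x∉ ∷ unique-++ˡ xs uq

  unique-++ʳ : ∀ xs {ys : List X} → Unique (xs ++ ys) → Unique ys
  unique-++ʳ [] uq = uq
  unique-++ʳ (x ∷ xs) (_ ∷ uq) = unique-++ʳ xs uq

  unique-after : ∀ u {x : X} {v} → Unique (u ++ x ∷ v) → All (x ≢_) v
  unique-after [] (x∉ ∷ _) = x∉
  unique-after (_ ∷ u) (_ ∷ uq) = unique-after u uq

  unique-map-injective : ∀ {Y : Set} {f : X → Y} {xs x y} → Unique (map f xs) →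
    x ∈ xs → y ∈ xs → f x ≡ f y → x ≡ y
  unique-map-injective _ (here refl) (here refl) _ = refl
  unique-map-injective {f = f} (fx∉ ∷ _) (here refl) (there y∈) e = ⊥-elim (All.lookup fx∉ (∈-map⁺ f y∈) e)
  unique-map-injective {f = f} (fy∉ ∷ _) (there x∈) (here refl) e = ⊥-elim (All.lookup fy∉ (∈-map⁺ f x∈) (sym e))
  unique-map-injective (_ ∷ uq) (there x∈) (there y∈) e = unique-map-injective uq x∈ y∈ e

  unique-sameMembers-↭ : ∀ (xs ys : List X) → Unique xs → Unique ys →
    (∀ {z} → z ∈ xs → z ∈ ys) → (∀ {z} → z ∈ ys → z ∈ xs) → xs ↭ ys
  unique-sameMembers-↭ [] [] _ _ _ _ = ↭-refl
  unique-sameMembers-↭ [] (y ∷ ys) _ _ _ ys⊆ with ys⊆ (here refl)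
  ... | ()
  unique-sameMembers-↭ (x ∷ xs) ys (x∉ ∷ uxs) uys xs⊆ ys⊆ with ∈-∃++ (xs⊆ (here refl))
  ... | p , q , refl = ↭-trans (prep x (unique-sameMembers-↭ xs (p ++ q) uxs upq xs⊆′ ys⊆′)) (↭-sym (shift x p q))
    where
    upq : Unique (p ++ q)
    upq = AllPairs.tail (unique-resp-↭ (shift x p q) uys)
    xs⊆′ : ∀ {z} → z ∈ xs → z ∈ p ++ q
    xs⊆′ z∈ with ∈-resp-↭ (shift x p q) (xs⊆ (there z∈))
    ... | here refl = ⊥-elim (All.lookup x∉ z∈ refl)
    ... | there z∈′ = z∈′
    ys⊆′ : ∀ {z} → z ∈ p ++ q → z ∈ xs
    ys⊆′ z∈ with ys⊆ (∈-resp-↭ (↭-sym (shift x p q)) (there z∈))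
    ... | here refl = ⊥-elim (All.lookup (AllPairs.head (unique-resp-↭ (shift x p q) uys)) z∈ refl)
    ... | there z∈′ = z∈′

  split-first : ∀ (p p′ : List X) {z q q′} → z ∉ p → z ∉ p′ →
    p ++ z ∷ q ≡ p′ ++ z ∷ q′ → p ≡ p′ × q ≡ q′
  split-first [] [] _ _ eq = refl , ∷-injectiveʳ eq
  split-first [] (a ∷ p′) _ z∉p′ eq = ⊥-elim (z∉p′ (here (proj₁ (∷-injective eq))))
  split-first (a ∷ p) [] z∉p _ eq = ⊥-elim (z∉p (here (sym (proj₁ (∷-injective eq)))))
  split-first (a ∷ p) (b ∷ p′) z∉p z∉p′ eq with ∷-injective eq
  ... | refl , eq′ with split-first p p′ (z∉p ∘ there) (z∉p′ ∘ there) eq′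
  ...   | refl , q≡q′ = refl , q≡q′

  -- appending a letter makes a word longer (the measure of decoding)
  snoc-longer : ∀ (u : List X) c → length u < length (u ++ [ c ])
  snoc-longer [] c = s≤s z≤n
  snoc-longer (_ ∷ u) c = s≤s (snoc-longer u c)

  module _ {R : X → X → Set} where

    linked-++ˡ : ∀ xs {ys} → Linked R (xs ++ ys) → Linked R xs
    linked-++ˡ [] _ = []
    linked-++ˡ (x ∷ []) _ = [-]
    linked-++ˡ (x ∷ y ∷ xs) (r ∷ l) = r ∷ linked-++ˡ (y ∷ xs) l

    linked-++ʳ : ∀ xs {ys} → Linked R (xs ++ ys) → Linked R ys
    linked-++ʳ [] l = l
    linked-++ʳ (x ∷ xs) l = linked-++ʳ xs (Linked.tail l)

    linked-after : ∀ u {x ys} → Linked R (u ++ x ∷ ys) → Connected R (just x) (head ys)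
    linked-after [] l = Linked.head′ l
    linked-after (_ ∷ u) l = linked-after u (Linked.tail l)

    linked-append : ∀ {xs c} → Linked R xs → All (λ y → R y c) xs → Linked R (xs ++ [ c ])
    linked-append [] _ = [-]
    linked-append [-] (r ∷ []) = r ∷ [-]
    linked-append (r₁ ∷ l) (_ ∷ rs) = r₁ ∷ linked-append l rs

    linked-snoc : ∀ xs {c q} → Linked R (xs ++ [ c ]) → R c q → Linked R ((xs ++ [ c ]) ++ [ q ])
    linked-snoc [] _ r = r ∷ [-]
    linked-snoc (x ∷ []) (r₁ ∷ _) r = r₁ ∷ r ∷ [-]
    linked-snoc (x ∷ y ∷ xs) (r₁ ∷ l) r = r₁ ∷ linked-snoc (y ∷ xs) l r

  connected-map : ∀ {R S : X → X → Set} {x m} → (∀ {y} → R x y → S x y) →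
    Connected R (just x) m → Connected S (just x) m
  connected-map f (just r) = just (f r)
  connected-map f just-nothing = just-nothing

  all⇒first : ∀ {R : X → X → Set} {x} xs {ys} → All (R x) xs → xs ≢ [] → Connected R (just x) (head (xs ++ ys))
  all⇒first [] [] ne = ⊥-elim (ne refl)
  all⇒first (_ ∷ _) (r ∷ _) _ = just r

least : ∀ {P : ℕ → Set} → (∀ i → Dec (P i)) → ∀ j → P j → ∃ λ m → P m × (∀ i → i < m → ¬ P i)
least {P} P? j pj = search j 0 (λ _ ()) pj
  where
  search : ∀ k n → (∀ i → i < n → ¬ P i) → P (n + k) → ∃ λ m → P m × (∀ i → i < m → ¬ P i)
  search zero n below p = n , subst P (+-identityʳ n) p , below
  search (suc k) n below p with P? n
  ... | yes pn = n , pn , below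
  ... | no ¬pn = search k (suc n) below′ (subst P (+-suc n k) p)
    where
    below′ : ∀ i → i < suc n → ¬ P i
    below′ i i<1+n with m<1+n⇒m<n∨m≡n i<1+n
    ... | inj₁ i<n = below i i<n
    ... | inj₂ refl = ¬pn

maximum : ∀ (A : List ℕ) → A ≢ [] → ∃ λ M → M ∈ A × All (_≤ M) A
maximum [] ne = ⊥-elim (ne refl)
maximum (a ∷ []) _ = a , here refl , ≤-refl ∷ []
maximum (a ∷ b ∷ as) _ with maximum (b ∷ as) (λ ())
... | M , M∈ , below with a ≤? M
...   | yes a≤M = M , there M∈ , a≤M ∷ below
...   | no a≰M = a , here refl , ≤-refl ∷ All.map (λ y≤M → ≤-trans y≤M (<⇒≤ (≰⇒> a≰M))) below

iter-suc : ∀ (f : ℕ → ℕ) k x → iter f (suc k) x ≡ iter f k (f x)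
iter-suc f zero x = refl
iter-suc f (suc k) x = cong f (iter-suc f k x)

iter-+ : ∀ (f : ℕ → ℕ) k j x → iter f (k + j) x ≡ iter f k (iter f j x)
iter-+ f zero j x = refl
iter-+ f (suc k) j x = cong f (iter-+ f k j x)

iter-periodic : ∀ (f : ℕ → ℕ) m x → iter f (suc m) x ≡ x → ∀ r → iter f r x ≡ iter f (r % suc m) x
iter-periodic f m x back r = begin
  iter f r x                                ≡⟨ cong (λ k → iter f k x) (m≡m%n+[m/n]*n r p) ⟩
  iter f (r % p + (r / p) * p) x            ≡⟨ iter-+ f (r % p) ((r / p) * p) x ⟩
  iter f (r % p) (iter f ((r / p) * p) x)   ≡⟨ cong (iter f (r % p)) (multiple (r / p)) ⟩
  iter f (r % p) x                          ∎
  where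
  open ≡-Reasoning
  p : ℕ
  p = suc m
  multiple : ∀ q → iter f (q * p) x ≡ x
  multiple zero = refl
  multiple (suc q) = trans (iter-+ f p (q * p) x) (trans (cong (iter f p) (multiple q)) back)

orbit : (ℕ → ℕ) → ℕ → ℕ → List ℕ
orbit f x zero = []
orbit f x (suc n) = f x ∷ orbit f (f x) n

orbit-∈ : ∀ (f : ℕ → ℕ) x n {y} → y ∈ x ∷ orbit f x n → ∃ λ i → i ≤ n × iter f i x ≡ y
orbit-∈ f x n (here refl) = 0 , z≤n , refl
orbit-∈ f x (suc n) (there y∈) with orbit-∈ f (f x) n y∈
... | i , i≤n , e = suc i , s≤s i≤n , trans (iter-suc f i x) e

∈-orbit : ∀ (f : ℕ → ℕ) x n i → i ≤ n → iter f i x ∈ x ∷ orbit f x n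
∈-orbit f x n zero _ = here refl
∈-orbit f x (suc n) (suc i) (s≤s i≤n) =
  there (subst (_∈ f x ∷ orbit f (f x) n) (sym (iter-suc f i x)) (∈-orbit f (f x) n i i≤n))

orbit-unique : ∀ (f : ℕ → ℕ) x n → (∀ i k → i + suc k ≤ n → iter f i x ≢ iter f (i + suc k) x) →
  Unique (x ∷ orbit f x n)
orbit-unique f x zero _ = [] ∷ []
orbit-unique f x (suc n) distinct = All.tabulate x≢ ∷ orbit-unique f (f x) n distinct′
  where
  x≢ : ∀ {y} → y ∈ f x ∷ orbit f (f x) n → x ≢ y
  x≢ y∈ with orbit-∈ f (f x) n y∈
  ... | i , i≤n , e = λ x≡y → distinct 0 i (s≤s i≤n) (trans x≡y (trans (sym e) (sym (iter-suc f i x))))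
  distinct′ : ∀ i k → i + suc k ≤ n → iter f i (f x) ≢ iter f (i + suc k) (f x)
  distinct′ i k le e = distinct (suc i) k (s≤s le) (trans (iter-suc f i x) (trans e (sym (iter-suc f (i + suc k) x))))

-- Paths.  Path f x xs z: f maps every letter of x ∷ xs to the next one
-- and the last letter to z.  A permutation σ is the cycle (x, xs…) iff
-- Path σ x xs x.

Path : (ℕ → ℕ) → ℕ → List ℕ → ℕ → Set
Path f x xs z = map f (x ∷ xs) ≡ xs ++ [ z ]

path-tail : ∀ {f x y ys z} → Path f x (y ∷ ys) z → f x ≡ y × Path f y ys z
path-tail = ∷-injective

orbit-path : ∀ (f : ℕ → ℕ) x n → Path f x (orbit f x n) (iter f (suc n) x)
orbit-path f x zero = refl
orbit-path f x (suc n) = cong (f x ∷_) (trans (orbit-path f (f x) n)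
  (cong (λ z → orbit f (f x) n ++ [ z ]) (sym (iter-suc f (suc n) x))))

-- a path is the orbit of its first letter, so it is determined by its length
path-orbit : ∀ {f x xs z} → Path f x xs z → xs ≡ orbit f x (length xs)
path-orbit {xs = []} _ = refl
path-orbit {xs = y ∷ ys} path with path-tail path
... | refl , path′ = cong (_ ∷_) (path-orbit path′)

path-determined : ∀ {f x xs ys z z′} → Path f x xs z → Path f x ys z′ → length xs ≡ length ys → xs ≡ ys
path-determined {f} {x} p q len = trans (path-orbit p) (trans (cong (orbit f x) len) (sym (path-orbit q)))

paths-agree : ∀ {f g x xs z} → Path f x xs z → Path g x xs z → All (λ y → f y ≡ g y) (x ∷ xs)
paths-agree p q = pointwise _ (trans p (sym q))
  where
  pointwise : ∀ {f g : ℕ → ℕ} ys → map f ys ≡ map g ys → All (λ y → f y ≡ g y) ys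
  pointwise [] _ = []
  pointwise (y ∷ ys) e = proj₁ (∷-injective e) ∷ pointwise ys (proj₂ (∷-injective e))

path-steps⁻ : ∀ {R : ℕ → ℕ → Set} {f x xs z} → Path f x xs z →
  Linked R (x ∷ xs ++ [ z ]) → All (λ y → R y (f y)) (x ∷ xs)
path-steps⁻ {R} {xs = []} path (r ∷ [-]) = subst (R _) (sym (proj₁ (∷-injective path))) r ∷ []
path-steps⁻ {xs = y ∷ ys} path (r ∷ l) with path-tail path
... | refl , path′ = r ∷ path-steps⁻ path′ l

path-steps⁺ : ∀ {R : ℕ → ℕ → Set} {f x xs z} → Path f x xs z →
  All (λ y → R y (f y)) (x ∷ xs) → Linked R (x ∷ xs ++ [ z ])
path-steps⁺ {R} {xs = []} path (r ∷ []) = subst (R _) (proj₁ (∷-injective path)) r ∷ [-]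
path-steps⁺ {xs = y ∷ ys} path (r ∷ rs) with path-tail path
... | refl , path′ = r ∷ path-steps⁺ path′ rs

path-reach-from : ∀ {f x xs z y} → Path f x xs z → y ∈ x ∷ xs → ∃ λ k → iter f k x ≡ y
path-reach-from _ (here refl) = 0 , refl
path-reach-from {f} {x} {xs = _ ∷ _} path (there y∈) with path-tail path
... | refl , path′ with path-reach-from path′ y∈
...   | k , e = suc k , trans (iter-suc f k x) e

path-reach-end : ∀ {f x xs z y} → Path f x xs z → y ∈ x ∷ xs → ∃ λ k → iter f k y ≡ z
path-reach-end {xs = []} path (here refl) = 1 , proj₁ (∷-injective path)
path-reach-end {f} {x} {xs = _ ∷ _} path (here refl) with path-tail path
... | refl , path′ with path-reach-end path′ (here refl)
...   | k , e = suc k , trans (iter-suc f k x) e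
path-reach-end {xs = _ ∷ _} path (there y∈) = path-reach-end (proj₂ (path-tail path)) y∈

nextIn-here : ∀ f a b rest → nextIn f (a ∷ b ∷ rest) a ≡ b
nextIn-here f a b rest with a ≟ a
... | yes _ = refl
... | no a≢a = ⊥-elim (a≢a refl)

nextIn-last : ∀ f a → nextIn f [ a ] a ≡ f
nextIn-last f a with a ≟ a
... | yes _ = refl
... | no a≢a = ⊥-elim (a≢a refl)

nextIn-skip : ∀ f a b rest {y} → y ≢ a → nextIn f (a ∷ b ∷ rest) y ≡ nextIn f (b ∷ rest) y
nextIn-skip f a b rest {y} y≢a with y ≟ a
... | yes y≡a = ⊥-elim (y≢a y≡a)
... | no _ = refl

nextIn-path : ∀ f a as → Unique (a ∷ as) → Path (nextIn f (a ∷ as)) a as f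
nextIn-path f a [] _ = cong [_] (nextIn-last f a)
nextIn-path f a (b ∷ rest) (a∉ ∷ uq) =
  cong₂ _∷_ (nextIn-here f a b rest) (trans (map-cong-local skip) (nextIn-path f b rest uq))
  where
  skip : All (λ y → nextIn f (a ∷ b ∷ rest) y ≡ nextIn f (b ∷ rest) y) (b ∷ rest)
  skip = All.map (λ a≢y → nextIn-skip f a b rest (a≢y ∘ sym)) a∉

path-rotate : ∀ {f a} p {M} → Path f a (p ++ [ M ]) a → Path f M (a ∷ p) M
path-rotate {f} {a} p {M} path = cong₂ _∷_ (∷ʳ-injectiveʳ (map f (a ∷ p)) (p ++ [ M ]) lastStep)
                                             (proj₁ (∷ʳ-injective (map f (a ∷ p)) (p ++ [ M ]) lastStep))
  where
  lastStep : map f (a ∷ p) ++ [ f M ] ≡ (p ++ [ M ]) ++ [ a ]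
  lastStep = trans (sym (map-++ f (a ∷ p) [ M ])) path

cycleOf-path : ∀ p {M} → Unique (p ++ [ M ]) → Path (cycleOf (p ++ [ M ])) M p M
cycleOf-path [] {M} _ = cong [_] (nextIn-last M M)
cycleOf-path (a ∷ p) uq = path-rotate p (nextIn-path a a (p ++ [ _ ]) uq)

closedDWalk⇒DCycle : ∀ {A σ M p} → Path σ M p M → Unique (M ∷ p) → M ∷ p ↭ A →
  Linked WeakDStep (M ∷ p ++ [ M ]) → IsDCycle A σ
closedDWalk⇒DCycle {A} {σ} {M} {p} path uq w↭A walk =
  ((closed , injective , onto) , proj₁ ∘ step , proj₂ ∘ step) , connected
  where
  fromA : ∀ {x} → x ∈ A → x ∈ M ∷ p
  fromA = ∈-resp-↭ (↭-sym w↭A)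
  toA : ∀ {x} → x ∈ M ∷ p → x ∈ A
  toA = ∈-resp-↭ w↭A
  -- by the path equation, the values of σ on the word are its letters rotated
  rotated : p ++ [ M ] ↭ M ∷ p
  rotated = ↭-sym (∷↭∷ʳ M p)
  closed : ∀ {x} → x ∈ A → σ x ∈ A
  closed {x} x∈ = toA (∈-resp-↭ rotated (subst (σ x ∈_) path (∈-map⁺ σ (fromA x∈))))
  injective : ∀ {x y} → x ∈ A → y ∈ A → σ x ≡ σ y → x ≡ y
  injective x∈ y∈ =
    unique-map-injective (subst Unique (sym path) (unique-resp-↭ (↭-sym rotated) uq)) (fromA x∈) (fromA y∈)
  onto : ∀ {y} → y ∈ A → ∃ λ x → x ∈ A × σ x ≡ y
  onto {y} y∈ with ∈-map⁻ σ (subst (y ∈_) (sym path) (∈-resp-↭ (↭-sym rotated) (fromA y∈)))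
  ... | x , x∈ , y≡σx = x , toA x∈ , sym y≡σx
  step : ∀ {x} → x ∈ A → WeakDStep x (σ x)
  step x∈ = All.lookup (path-steps⁻ path walk) (fromA x∈)
  connected : ∀ {x y} → x ∈ A → y ∈ A → ∃ λ k → iter σ k x ≡ y
  connected {x} x∈ y∈ with path-reach-end path (fromA x∈) | path-reach-from path (fromA y∈)
  ... | k₁ , x↦M | k₂ , M↦y = k₂ + k₁ , trans (iter-+ σ k₂ k₁ x) (trans (cong (iter σ k₂) x↦M) M↦y)

-- Canonical trees: ID trees with the planar order of the paper, indexed by
-- the direction of the root.

data Canonical : Dir → Tree → Set where
  canon : ∀ {d c ts} → HasDir d c → All (c ≺⟨ d ⟩_) (nodesF ts) →
          Linked (_≺⟨ opposite d ⟩_) (map root ts) → All (Canonical (opposite d)) ts →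
          Canonical d (node c ts)

roots-dir : ∀ {d} ts → All (Canonical d) ts → All (HasDir d ∘ root) ts
roots-dir [] [] = []
roots-dir (node c _ ∷ ts) (canon hc _ _ _ ∷ vs) = hc ∷ roots-dir ts vs

roots-⊆ : ∀ {P : ℕ → Set} ts → All P (nodesF ts) → All P (map root ts)
roots-⊆ [] _ = []
roots-⊆ (node a cs ∷ ts) (pa ∷ rest) = pa ∷ roots-⊆ ts (All.++⁻ʳ (nodesF cs) rest)

idConditions⇒canonical : ∀ d t → HasDir d (root t) → All IDLocal (subtrees t) →
  All CanonicalOrder (subtrees t) → Canonical d t
idConditions⇒canonicalF : ∀ d ts → All (HasDir d ∘ root) ts → All IDLocal (subtreesF ts) →
  All CanonicalOrder (subtreesF ts) → All (Canonical d) ts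
idConditions⇒canonical d (node c []) hc _ _ = canon hc [] [] []
idConditions⇒canonical up (node c (t ∷ ts)) hc (local ∷ locals) (order ∷ orders) =
  canon hc (proj₁ (proj₁ (local (λ ())) hc)) (proj₂ order hc)
    (idConditions⇒canonicalF down (t ∷ ts) (proj₂ (proj₁ (local (λ ())) hc)) locals orders)
idConditions⇒canonical down (node c (t ∷ ts)) hc (local ∷ locals) (order ∷ orders) =
  canon hc (proj₁ (proj₂ (local (λ ())) hc)) (proj₁ order hc)
    (idConditions⇒canonicalF up (t ∷ ts) (proj₂ (proj₂ (local (λ ())) hc)) locals orders)
idConditions⇒canonicalF d [] _ _ _ = []
idConditions⇒canonicalF d (t ∷ ts) (h ∷ hs) locals orders =
  idConditions⇒canonical d t h (All.++⁻ˡ (subtrees t) locals) (All.++⁻ˡ (subtrees t) orders)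
  ∷ idConditions⇒canonicalF d ts hs (All.++⁻ʳ (subtrees t) locals) (All.++⁻ʳ (subtrees t) orders)

canonical⇒idConditions : ∀ {d} t → Canonical d t → All IDLocal (subtrees t) × All CanonicalOrder (subtrees t)
canonical⇒idConditionsF : ∀ {d} ts → All (Canonical d) ts →
  All IDLocal (subtreesF ts) × All CanonicalOrder (subtreesF ts)
canonical⇒idConditions {up} (node c ts) (canon hc desc ch kids) =
  ((λ _ → (λ _ → desc , roots-dir ts kids) , (λ e → ⊥-elim (hc e))) ∷ proj₁ (canonical⇒idConditionsF ts kids)) ,
  (((λ e → ⊥-elim (hc e)) , (λ _ → ch)) ∷ proj₂ (canonical⇒idConditionsF ts kids))
canonical⇒idConditions {down} (node c ts) (canon hc desc ch kids) =
  ((λ _ → (λ o → ⊥-elim (o hc)) , (λ _ → desc , roots-dir ts kids)) ∷ proj₁ (canonical⇒idConditionsF ts kids)) ,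
  (((λ _ → ch) , (λ o → ⊥-elim (o hc))) ∷ proj₂ (canonical⇒idConditionsF ts kids))
canonical⇒idConditionsF [] [] = [] , []
canonical⇒idConditionsF (t ∷ ts) (v ∷ vs) =
  All.++⁺ (proj₁ (canonical⇒idConditions t v)) (proj₁ (canonical⇒idConditionsF ts vs)) ,
  All.++⁺ (proj₂ (canonical⇒idConditions t v)) (proj₂ (canonical⇒idConditionsF ts vs))

postorder-↭ : ∀ t → postorder t ↭ nodes t
postorderF-↭ : ∀ ts → postorderF ts ↭ nodesF ts
postorder-↭ (node a ts) = ↭-trans (↭-sym (∷↭∷ʳ a (postorderF ts))) (prep a (postorderF-↭ ts))
postorderF-↭ [] = ↭-refl
postorderF-↭ (t ∷ ts) = Perm.++⁺ (postorder-↭ t) (postorderF-↭ ts)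

postorder-nonempty : ∀ t → postorder t ≢ []
postorder-nonempty (node a ts) e with ++-conicalʳ (postorderF ts) [ a ] e
... | ()

canonical-≼ : ∀ {d t} → Canonical d t → All (root t ≼⟨ d ⟩_) (postorder t)
canonical-≼ (canon {ts = ts} _ desc _ _) =
  All.++⁺ (All.map ≺⇒≼ (All-resp-↭ (↭-sym (postorderF-↭ ts)) desc)) (≼-refl ∷ [])

walkT : ∀ {d t ws} → Canonical d t → Linked DStep ws →
  Connected (_≺⟨ d ⟩_) (just (root t)) (head ws) → Linked DStep (postorder t ++ ws)
walkF : ∀ {d b ts ws} → All (Canonical d) ts → Linked (_≺⟨ d ⟩_) (map root ts ++ [ b ]) →
  Linked DStep ws → Connected (_≼⟨ d ⟩_) (just b) (head ws) → Linked DStep (postorderF ts ++ ws)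
forest-first : ∀ {d x b ts ws} → All (Canonical d) ts → Linked (_≺⟨ d ⟩_) (x ∷ map root ts ++ [ b ]) →
  Connected (_≼⟨ d ⟩_) (just b) (head ws) → Connected (_≺⟨ d ⟩_) (just x) (head (postorderF ts ++ ws))

walkT {ws = ws} (canon {c = c} {ts} hc desc ch kids) lws first =
  subst (Linked DStep) (sym (++-assoc (postorderF ts) [ c ] ws))
    (walkF kids (linked-append ch (All.map ≺-opposite (roots-⊆ ts desc)))
       (connected-map (directed⇒DStep hc) first ∷′ lws) (just ≼-refl))
walkF [] _ lws _ = lws
walkF {ts = t ∷ ts} {ws} (v ∷ vs) lk lws first =
  subst (Linked DStep) (sym (++-assoc (postorder t) (postorderF ts) ws))
    (walkT v (walkF vs (Linked.tail lk) lws first) (forest-first vs lk first))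
forest-first {ts = []} {[]} [] _ _ = just-nothing
forest-first {ts = []} {_ ∷ _} [] (x≺b ∷ _) (just b≼w) = just (≺-≼-trans x≺b b≼w)
forest-first {ts = t ∷ ts} {ws} (v ∷ _) lk _ =
  subst (λ l → Connected _ (just _) (head l)) (sym (++-assoc (postorder t) (postorderF ts) ws))
    (all⇒first (postorder t) (All.map (≺-≼-trans (Linked.head lk)) (canonical-≼ v)) (postorder-nonempty t))

postorder-walk : ∀ {d t} → Canonical d t → Linked DStep (postorder t)
postorder-walk {t = t} v = subst (Linked DStep) (++-identityʳ (postorder t)) (walkT v [] just-nothing)

-- the root M of a canonical tree, larger than all its nodes, steps weakly to
-- the first letter of the postorder (an odd such root must be a leaf)
root-wraps : ∀ {d M ts} → Canonical d (node M ts) → All (_≤ M) (nodesF ts) →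
  Connected WeakDStep (just M) (head (postorderF ts ++ [ M ]))
root-wraps {ts = []} _ _ = just ((λ _ → ≤-refl) , (λ _ → ≤-refl))
root-wraps {up} {ts = node _ _ ∷ _} (canon _ (M<y ∷ _) _ _) (y≤M ∷ _) = ⊥-elim (<⇒≱ M<y y≤M)
root-wraps {down} {ts = t ∷ ts} (canon even _ _ _) below =
  all⇒first (postorderF (t ∷ ts))
    (All.map (λ y≤M → (λ odd → ⊥-elim (odd even)) , (λ _ → y≤M))
       (All-resp-↭ (↭-sym (postorderF-↭ (t ∷ ts))) below))
    (λ e → postorder-nonempty t (++-conicalˡ (postorder t) (postorderF ts) e))

idTree⇒canonical : ∀ {A t} → IsIDTree A t → Canonical (proj₁ (dirOf (root t))) t
idTree⇒canonical {t = t} (_ , _ , locals , orders) =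
  idConditions⇒canonical _ t (proj₂ (dirOf (root t))) locals orders

idTree-word : ∀ {A M ts} → IsIDTree A (node M ts) → M ∷ postorderF ts ↭ A
idTree-word {ts = ts} (nodes↭A , _) = ↭-trans (prep _ (postorderF-↭ ts)) nodes↭A

canonical⇒idTree : ∀ {A d M ts} → Canonical d (node M ts) → M ∷ postorderF ts ↭ A → All (_≤ M) A →
  IsIDTree A (node M ts)
canonical⇒idTree {ts = ts} v word below =
  nodes↭A , All-resp-↭ (↭-sym nodes↭A) below , canonical⇒idConditions _ v
  where
  nodes↭A : nodes (node _ ts) ↭ _
  nodes↭A = ↭-trans (prep _ (↭-sym (postorderF-↭ ts))) word

idTree-root-max : ∀ {A t₁ t₂} → IsIDTree A t₁ → IsIDTree A t₂ → root t₁ ≤ root t₂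
idTree-root-max {t₁ = node _ _} (nodes₁ , _) (nodes₂ , below₂ , _) =
  All.lookup (All-resp-↭ nodes₂ below₂) (∈-resp-↭ nodes₁ (here refl))

ψ-path : ∀ {A M ts} → Unique A → IsIDTree A (node M ts) → Path (ψ (node M ts)) M (postorderF ts) M
ψ-path {M = M} {ts} uA idt =
  cycleOf-path (postorderF ts) (unique-resp-↭ (∷↭∷ʳ M (postorderF ts)) (unique-resp-↭ (↭-sym (idTree-word idt)) uA))

-- the postorder of an ID tree, closed up at its root, is a closed walk of weak D-steps
ψ-isDCycle : ∀ {A} → Unique A → ∀ t → IsIDTree A t → IsDCycle A (ψ t)
ψ-isDCycle uA (node M ts) idt@(_ , M-max , _) =
  closedDWalk⇒DCycle (ψ-path uA idt) (unique-resp-↭ (↭-sym (idTree-word idt)) uA) (idTree-word idt) walk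
  where
  v : Canonical (proj₁ (dirOf M)) (node M ts)
  v = idTree⇒canonical idt
  walk : Linked WeakDStep (M ∷ postorderF ts ++ [ M ])
  walk = root-wraps v (All.tail M-max) ∷′ Linked.map DStep⇒WeakDStep (postorder-walk v)

-- Part 2: ψ is injective, because the postorder determines a canonical forest

forest-≼ : ∀ {d x ts} → All (Canonical d) ts → All (x ≺⟨ d ⟩_) (map root ts) →
  All (x ≼⟨ d ⟩_) (postorderF ts)
forest-≼ [] [] = []
forest-≼ (v ∷ vs) (r ∷ rs) = All.++⁺ (All.map (≺⇒≼ ∘ ≺-≼-trans r) (canonical-≼ v)) (forest-≼ vs rs)

first-root-≼ : ∀ {d t ts} → All (Canonical d) (t ∷ ts) → Linked (_≺⟨ d ⟩_) (map root (t ∷ ts)) →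
  All (root t ≼⟨ d ⟩_) (postorderF (t ∷ ts))
first-root-≼ (v ∷ vs) l = All.++⁺ (canonical-≼ v) (forest-≼ vs (AllPairs.head (Linked⇒AllPairs ≺-trans l)))

root-∈ : ∀ {c} cs r → c ∈ postorderF (node c cs ∷ r)
root-∈ cs r = ∈-++⁺ˡ (∈-++⁺ʳ (postorderF cs) (here refl))

not-descendant : ∀ {d c} cs → All (c ≺⟨ d ⟩_) (nodesF cs) → c ∉ postorderF cs
not-descendant cs desc c∈ = ≺-irrefl (All.lookup (All-resp-↭ (↭-sym (postorderF-↭ cs)) desc) c∈)

-- The first tree of the forest is recovered as follows: both first roots are
-- the extreme letter of the word, and the word splits at the first (unique)
-- occurrence of the root into the descendants and the rest of the forest.
postorderF-injective : ∀ {d ts₁ ts₂} → All (Canonical d) ts₁ → All (Canonical d) ts₂ →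
  Linked (_≺⟨ d ⟩_) (map root ts₁) → Linked (_≺⟨ d ⟩_) (map root ts₂) →
  postorderF ts₁ ≡ postorderF ts₂ → ts₁ ≡ ts₂
postorderF-injective {ts₁ = []} {[]} _ _ _ _ _ = refl
postorderF-injective {ts₁ = []} {t ∷ _} _ _ _ _ eq = ⊥-elim (postorder-nonempty t (++-conicalˡ _ _ (sym eq)))
postorderF-injective {ts₁ = t ∷ _} {[]} _ _ _ _ eq = ⊥-elim (postorder-nonempty t (++-conicalˡ _ _ eq))
postorderF-injective {ts₁ = node c₁ cs₁ ∷ r₁} {node c₂ cs₂ ∷ r₂}
  vs₁@(canon _ desc₁ ch₁ k₁ ∷ rs₁) vs₂@(canon _ desc₂ ch₂ k₂ ∷ rs₂) l₁ l₂ eq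
  with ≼-antisym (All.lookup (first-root-≼ vs₁ l₁) (subst (c₂ ∈_) (sym eq) (root-∈ cs₂ r₂)))
                 (All.lookup (first-root-≼ vs₂ l₂) (subst (c₁ ∈_) eq (root-∈ cs₁ r₁)))
... | refl with split-first (postorderF cs₁) (postorderF cs₂) (not-descendant cs₁ desc₁) (not-descendant cs₂ desc₂)
                  (trans (sym (++-assoc (postorderF cs₁) [ c₁ ] (postorderF r₁)))
                         (trans eq (++-assoc (postorderF cs₂) [ c₁ ] (postorderF r₂))))
... | cs-eq , r-eq = cong₂ _∷_ (cong (node c₁) (postorderF-injective k₁ k₂ ch₁ ch₂ cs-eq))
                               (postorderF-injective rs₁ rs₂ (Linked.tail l₁) (Linked.tail l₂) r-eq)

-- two ID trees on A with the same ψ have the same root M; their postorders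
-- are then paths of the same permutation from M of the same length
ψ-injective : ∀ {A} → Unique A → ∀ t₁ t₂ → IsIDTree A t₁ → IsIDTree A t₂ →
  ψ t₁ ≈[ A ] ψ t₂ → t₁ ≡ t₂
ψ-injective uA (node M₁ ts₁) (node M₂ ts₂) idt₁ idt₂ agree
  with ≤-antisym (idTree-root-max idt₁ idt₂) (idTree-root-max idt₂ idt₁)
... | refl with idTree⇒canonical idt₁ | idTree⇒canonical idt₂
... | canon _ _ ch₁ k₁ | canon _ _ ch₂ k₂ =
  cong (node M₁) (postorderF-injective k₁ k₂ ch₁ ch₂ (path-determined path₁ (ψ-path uA idt₂) sameLength))
  where
  path₁ : Path (ψ (node M₁ ts₂)) M₁ (postorderF ts₁) M₁
  path₁ = trans (sym (map-cong-local (All.tabulate (agree ∘ ∈-resp-↭ (idTree-word idt₁))))) (ψ-path uA idt₁)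
  sameLength : length (postorderF ts₁) ≡ length (postorderF ts₂)
  sameLength = suc-injective (trans (↭-length (idTree-word idt₁)) (sym (↭-length (idTree-word idt₂))))

Forest : Dir → ℕ → List ℕ → Set
Forest d q w = ∃ λ ts → postorderF ts ≡ w × All (Canonical d) ts × Linked (_≺⟨ d ⟩_) (map root ts ++ [ q ])

-- the last letter of a word to be decoded is the root of the last tree:
-- it has direction d and lies before the bound q
EndsBefore : Dir → ℕ → List ℕ → Set
EndsBefore d q = LastP (λ c → HasDir d c × c ≺⟨ d ⟩ q)

plant : ∀ {d q c u₁ v} → HasDir d c → c ≺⟨ d ⟩ q → All (c ≺⟨ d ⟩_) v →
  Forest (opposite d) c v → Forest d c u₁ → Forest d q (u₁ ++ v ++ [ c ])
plant {d} {q} {c} hc c≺q beyond (tsv , refl , cv , lv) (tsu , refl , cu , lu) =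
  tsu ++ [ tc ] , postorder-eq , All.++⁺ cu (tree ∷ []) ,
  subst (Linked (_≺⟨ d ⟩_)) (cong (_++ [ q ]) (sym (map-++ root tsu [ tc ]))) (linked-snoc (map root tsu) lu c≺q)
  where
  tc : Tree
  tc = node c tsv
  tree : Canonical d tc
  tree = canon hc (All-resp-↭ (postorderF-↭ tsv) beyond) (linked-++ˡ (map root tsv) lv) cv
  postorderF-++ : ∀ xs ys → postorderF (xs ++ ys) ≡ postorderF xs ++ postorderF ys
  postorderF-++ [] ys = refl
  postorderF-++ (x ∷ xs) ys =
    trans (cong (postorder x ++_) (postorderF-++ xs ys)) (sym (++-assoc (postorder x) (postorderF xs) (postorderF ys)))
  postorder-eq : postorderF (tsu ++ [ tc ]) ≡ postorderF tsu ++ postorderF tsv ++ [ c ]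
  postorder-eq = trans (postorderF-++ tsu [ tc ]) (cong (postorderF tsu ++_) (++-identityʳ (postorder tc)))

-- the longest suffix v beyond c consists of descendants of c: it ends in a
-- letter of the opposite direction before c
descendants-end : ∀ {d c} u₁ v → All (c ≺⟨ d ⟩_) v → Linked DStep (u₁ ++ v ++ [ c ]) →
  EndsBefore (opposite d) c v
descendants-end {d} {c} u₁ v beyond lk v₀ e refl with linked-after (u₁ ++ v₀) (subst (Linked DStep) reassoc lk)
  where
  reassoc : u₁ ++ (v₀ ++ [ e ]) ++ [ c ] ≡ (u₁ ++ v₀) ++ e ∷ [ c ]
  reassoc = trans (cong (u₁ ++_) (++-assoc v₀ [ e ] [ c ])) (sym (++-assoc u₁ v₀ (e ∷ [ c ])))
... | just e→c = DStep-dir e→c (≺⇒≼ (≺-opposite c≺e)) , ≺-opposite c≺e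
  where
  c≺e : c ≺⟨ d ⟩ e
  c≺e = All.lookup beyond (∈-++⁺ʳ v₀ (here refl))

-- the rest u₁ ends in a letter c′ not beyond c; it lies before c, and the
-- D-step leaving it reaches weakly beyond c, so it has direction d
ancestors-end : ∀ {d c} u₁ v → LastP (¬_ ∘ (c ≺⟨ d ⟩_)) u₁ → All (c ≺⟨ d ⟩_) v →
  Unique (u₁ ++ v ++ [ c ]) → Linked DStep (u₁ ++ v ++ [ c ]) → EndsBefore d c u₁
ancestors-end {d} {c} u₁ v notBeyond beyond uq lk u₀ c′ refl =
  DStep-dir′ v beyond (linked-after u₀ lk′) c′≼c , c′≺c
  where
  reassoc : (u₀ ++ [ c′ ]) ++ v ++ [ c ] ≡ u₀ ++ c′ ∷ v ++ [ c ]
  reassoc = ++-assoc u₀ [ c′ ] (v ++ [ c ])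
  lk′ : Linked DStep (u₀ ++ c′ ∷ v ++ [ c ])
  lk′ = subst (Linked DStep) reassoc lk
  c′≼c : c′ ≼⟨ d ⟩ c
  c′≼c = ≺-connex (notBeyond u₀ c′ refl)
  c′≺c : c′ ≺⟨ d ⟩ c
  c′≺c = ≼∧≢⇒≺ c′≼c (All.lookup (unique-after u₀ (subst Unique reassoc uq)) (∈-++⁺ʳ v (here refl)))
  DStep-dir′ : ∀ v → All (c ≺⟨ d ⟩_) v → Connected DStep (just c′) (head (v ++ [ c ])) →
    c′ ≼⟨ d ⟩ c → HasDir d c′
  DStep-dir′ [] _ (just step) c′≼c = DStep-dir step c′≼c
  DStep-dir′ (_ ∷ _) (c≺e ∷ _) (just step) c′≼c = DStep-dir step (≼-trans c′≼c (≺⇒≼ c≺e))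

-- Decoding, by recursion on the length: the last letter c is the root of the
-- last tree, the longest suffix before it lying beyond c are its descendants,
-- and the remaining prefix is decoded as the forest before c.
decode : ∀ n d q w → length w ≤ n → Unique w → Linked DStep w → EndsBefore d q w → Forest d q w
decodeSplit : ∀ n d q u₁ v c → length (u₁ ++ v) ≤ n →
  Unique (u₁ ++ v ++ [ c ]) → Linked DStep (u₁ ++ v ++ [ c ]) → HasDir d c → c ≺⟨ d ⟩ q →
  All (c ≺⟨ d ⟩_) v → LastP (¬_ ∘ (c ≺⟨ d ⟩_)) u₁ → Forest d q (u₁ ++ v ++ [ c ])

decode zero d q [] _ _ _ _ = [] , refl , [] , [-]
decode (suc n) d q w len uq lk last with initLast w
... | [] = [] , refl , [] , [-]
... | u ∷ʳ′ c with splitSuffix (c ≺?⟨ d ⟩_) u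
...   | u₁ , v , refl , beyond , notBeyond =
  subst (Forest d q) (sym (++-assoc u₁ v [ c ]))
    (decodeSplit n d q u₁ v c (s≤s⁻¹ (<-≤-trans (snoc-longer (u₁ ++ v) c) len))
      (subst Unique (++-assoc u₁ v [ c ]) uq) (subst (Linked DStep) (++-assoc u₁ v [ c ]) lk)
      (proj₁ (last (u₁ ++ v) c refl)) (proj₂ (last (u₁ ++ v) c refl)) beyond notBeyond)
decodeSplit n d q u₁ v c len uq lk hc c≺q beyond notBeyond =
  plant hc c≺q beyond
    (decode n (opposite d) c v (≤-trans (length-++-≤ʳ v {u₁}) len) (unique-++ˡ v (unique-++ʳ u₁ uq))
       (linked-++ˡ v (linked-++ʳ u₁ lk)) (descendants-end u₁ v beyond lk))
    (decode n d c u₁ (≤-trans (length-++-≤ˡ u₁) len) (unique-++ˡ u₁ uq) (linked-++ˡ u₁ lk)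
       (ancestors-end u₁ v notBeyond beyond uq lk))

walk-into-max : ∀ {M} w → All (_< M) w → Linked DStep (w ++ [ M ]) → EndsBefore up M w
walk-into-max {M} w below lk u c refl with linked-after u (subst (Linked DStep) (++-assoc u [ c ] [ M ]) lk)
... | just c→M = DStep-dir c→M (<⇒≤ c<M) , c<M
  where
  c<M : c < M
  c<M = All.lookup below (∈-++⁺ʳ u (here refl))

-- A duplicate-free closed walk of weak D-steps from its maximum M is the
-- postorder of a canonical tree rooted at M.  (If M is odd, the walk cannot
-- leave M, so the tree is a single node.)
decodeTree : ∀ {M p} → Unique (M ∷ p) → Linked WeakDStep (M ∷ p ++ [ M ]) → All (_< M) p →
  Σ Dir λ d → ∃ λ ts → postorderF ts ≡ p × Canonical d (node M ts)
decodeTree {M} {[]} _ _ _ = proj₁ (dirOf M) , [] , refl , canon (proj₂ (dirOf M)) [] [] []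
decodeTree {M} {a ∷ p} uq (M→a ∷ walk) below with parity M
... | inj₂ odd = ⊥-elim (<⇒≱ (All.head below) (proj₁ M→a odd))
... | inj₁ even with decode (length (a ∷ p)) up M (a ∷ p) ≤-refl
                       (unique-++ˡ (a ∷ p) uq′) (linked-++ˡ (a ∷ p) lk) (walk-into-max (a ∷ p) below lk)
  where
  uq′ : Unique ((a ∷ p) ++ [ M ])
  uq′ = unique-resp-↭ (∷↭∷ʳ M (a ∷ p)) uq
  lk : Linked DStep ((a ∷ p) ++ [ M ])
  lk = linked-weak⇒strict walk uq′
... | ts , post , trees , roots =
  down , ts , post , canon even (All-resp-↭ (postorderF-↭ ts) (subst (All (_< M)) (sym post) below))
                             (linked-++ˡ (map root ts) roots) trees

iter-closed : ∀ {A σ} → (∀ {x} → x ∈ A → σ x ∈ A) → ∀ k {x} → x ∈ A → iter σ k x ∈ A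
iter-closed closed zero x∈ = x∈
iter-closed closed (suc k) x∈ = closed (iter-closed closed k x∈)

iter-cancel : ∀ {A σ} → IsPermutationOf A σ → ∀ k {x y} → x ∈ A → y ∈ A →
  iter σ k x ≡ iter σ k y → x ≡ y
iter-cancel _ zero _ _ e = e
iter-cancel perm@(closed , injective , _) (suc k) x∈ y∈ e =
  iter-cancel perm k x∈ y∈ (injective (iter-closed closed k x∈) (iter-closed closed k y∈) e)

cycleWord : ∀ {A σ M} → IsPermutationOf A σ → (∀ {x y} → x ∈ A → y ∈ A → ∃ λ k → iter σ k x ≡ y) →
  Unique A → M ∈ A → ∃ λ p → Path σ M p M × Unique (M ∷ p) × M ∷ p ↭ A
cycleWord {A} {σ} {M} perm@(closed , _) connected uA M∈ =
  p , subst (Path σ M p) returns (orbit-path σ M m) , uq , unique-sameMembers-↭ (M ∷ p) A uq uA orbit⊆A A⊆orbit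
  where
  returnsAt : ∃ λ k → iter σ (suc k) M ≡ M
  returnsAt with connected (closed M∈) M∈
  ... | k , e = k , trans (iter-suc σ k M) e
  period : ∃ λ m → iter σ (suc m) M ≡ M × (∀ i → i < m → iter σ (suc i) M ≢ M)
  period = least (λ i → iter σ (suc i) M ≟ M) (proj₁ returnsAt) (proj₂ returnsAt)
  m : ℕ
  m = proj₁ period
  returns : iter σ (suc m) M ≡ M
  returns = proj₁ (proj₂ period)
  p : List ℕ
  p = orbit σ M m
  uq : Unique (M ∷ p)
  uq = orbit-unique σ M m λ i k i+k<m e → proj₂ (proj₂ period) k (≤-trans (m≤n+m (suc k) i) i+k<m)
         (sym (iter-cancel perm i M∈ (iter-closed closed (suc k) M∈) (trans e (iter-+ σ i (suc k) M))))
  orbit⊆A : ∀ {y} → y ∈ M ∷ p → y ∈ A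
  orbit⊆A y∈ with orbit-∈ σ M m y∈
  ... | i , _ , e = subst (_∈ A) e (iter-closed closed i M∈)
  A⊆orbit : ∀ {y} → y ∈ A → y ∈ M ∷ p
  A⊆orbit y∈ with connected M∈ y∈
  ... | r , e = subst (_∈ M ∷ p) (trans (sym (iter-periodic σ m M returns r)) e)
                  (∈-orbit σ M m (r % suc m) (s≤s⁻¹ (m%n<n r (suc m))))

others-below : ∀ {M p} → Unique (M ∷ p) → All (_≤ M) (M ∷ p) → All (_< M) p
others-below (M∉ ∷ _) (_ ∷ ≤M) = All.zipWith (λ (y≤M , M≢y) → ≤∧≢⇒< y≤M (M≢y ∘ sym)) (≤M , M∉)

dPermutation-walk : ∀ {A σ M p} → IsDPermutation A σ → Path σ M p M → M ∷ p ↭ A →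
  Linked WeakDStep (M ∷ p ++ [ M ])
dPermutation-walk (_ , oddUp , evenDown) path word =
  path-steps⁺ path (All.tabulate λ y∈ → oddUp (∈-resp-↭ word y∈) , evenDown (∈-resp-↭ word y∈))

-- the orbit of the maximum M under a D-cycle is a closed D-walk; decoding it
-- gives an ID tree whose ψ follows the same path, hence equals σ on A
ψ-surjective : ∀ {A M} → Unique A → M ∈ A → All (_≤ M) A →
  ∀ σ → IsDCycle A σ → Σ Tree λ t → IsIDTree A t × ψ t ≈[ A ] σ
ψ-surjective {M = M} uA M∈ below σ (dperm@(perm , _) , connected) with cycleWord perm connected uA M∈
... | p , path , uq , word
  with decodeTree uq (dPermutation-walk dperm path word) (others-below uq (All-resp-↭ (↭-sym word) below))
... | _ , ts , refl , tree =
  node M ts , idt , λ x∈ → All.lookup (paths-agree (ψ-path uA idt) path) (∈-resp-↭ (↭-sym word) x∈)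
  where
  idt : IsIDTree _ (node M ts)
  idt = canonical⇒idTree tree word below

lemma3p4 : (n : ℕ) (A : List ℕ) → IsNodeSet n A →
    ((t : Tree) → IsIDTree A t → IsDCycle A (ψ t))
  × ((t₁ t₂ : Tree) → IsIDTree A t₁ → IsIDTree A t₂ → ψ t₁ ≈[ A ] ψ t₂ → t₁ ≡ t₂)
  × ((σ : ℕ → ℕ) → IsDCycle A σ → Σ Tree (λ t → IsIDTree A t × ψ t ≈[ A ] σ))
lemma3p4 n A (uA , _ , nonempty) with maximum A nonempty
... | M , M∈ , below = ψ-isDCycle uA , ψ-injective uA , ψ-surjective uA M∈ below
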